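{- Let $T_1$ and $T_2$ be ditrees of order at least $3$ such that $\gamma(T_1\mathbin{\Box} T_2)=\gamma(T_1)\gamma(T_2)$. If $P_1$ and $P_2$ are maximum packings of $T_1$ and $T_2$, respectively, then for each $i\in\{1,2\}$ the set $P_i$ is a dominating set of the underlying graph of $T_i$. Moreover, either every maximum packing of $T_1$ contains all isolated leaves of $T_1$, or every maximum packing of $T_2$ contains all isolated leaves of $T_2$.
   Context: All digraphs are finite, and their arc relation is irreflexive. The underlying graph of a digraph is the undirected graph in which $u,v$ are adjacent iff $uv$ or $vu$ is an arc; a ditree is a digraph whose underlying graph is a tree. A leaf of a digraph is a leaf of its underlying graph; an isolated leaf is a leaf with no in-neighbors. For a digraph $D$, $N^-_D[v]$ is $v$ together with its in-neighbors. A packing is a set $P$ with $N^-_D[x]\cap N^-_D[y]=\emptyset$ for all distinct $x,y\in P$; a maximum packing is one of maximum size. A set $S$ dominates a digraph if every vertex not in $S$ is an out-neighbor of some vertex of $S$, and $\gamma$ is the minimum size of such a set; a set dominates an undirected graph if every vertex not in it is adjacent to a vertex in it. The Cartesian product $T_1\mathbin{\Box} T_2$ has vertex set $V(T_1)\times V(T_2)$, with an arc from $(a_1,b_1)$ to $(a_2,b_2)$ iff either $a_1=a_2$ and $b_1b_2\in A(T_2)$, or $b_1=b_2$ and $a_1a_2\in A(T_1)$. -}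

module Defs where

open import Data.Nat using (ℕ; suc; _≤_; _*_)
open import Data.Fin using (Fin; remQuot)
open import Data.Fin.Subset using (Subset; _∈_; ∣_∣)
open import Data.Bool using (Bool; true; false; _∧_; _∨_)
open import Data.Fin using (_≟_)
open import Relation.Nullary.Decidable using (⌊_⌋)
open import Data.List using (List; []; _∷_; length)
open import Data.List.Relation.Unary.Unique.Propositional using (Unique)
open import Data.Product using (Σ; ∃; _×_; _,_; proj₁; proj₂)
open import Data.Sum using (_⊎_)
open import Relation.Binary.PropositionalEquality using (_≡_; _≢_)
open import Relation.Nullary using (¬_)
open import Data.Unit using (⊤)

Digraph : ℕ → Set
Digraph n = Fin n → Fin n → Bool

Arc : ∀ {n} → Digraph n → Fin n → Fin n → Set
Arc D u v = D u v ≡ true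

Irreflexive : ∀ {n} → Digraph n → Set
Irreflexive D = ∀ v → D v v ≡ false

Adj : ∀ {n} → Digraph n → Fin n → Fin n → Set
Adj D u v = Arc D u v ⊎ Arc D v u

data Walk {n} (D : Digraph n) : Fin n → Fin n → Set where
  here : ∀ v → Walk D v v
  step : ∀ {u v w} → Adj D u v → Walk D v w → Walk D u w

Connected : ∀ {n} → Digraph n → Set
Connected D = ∀ u v → Walk D u v

Chain : ∀ {n} → Digraph n → List (Fin n) → Set
Chain D []           = ⊤
Chain D (x ∷ [])     = ⊤
Chain D (x ∷ y ∷ xs) = Adj D x y × Chain D (y ∷ xs)

IsCycle : ∀ {n} → Digraph n → Fin n → List (Fin n) → Set
IsCycle D v₀ vs = 3 ≤ length (v₀ ∷ vs) × Unique (v₀ ∷ vs) × Chain D (v₀ ∷ vs)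
                  × Last vs
  where
  Last : List _ → Set
  Last []       = ⊤
  Last (x ∷ []) = Adj D x v₀
  Last (x ∷ y ∷ ys) = Last (y ∷ ys)

Acyclic : ∀ {n} → Digraph n → Set
Acyclic D = ∀ v₀ vs → ¬ IsCycle D v₀ vs

IsDitree : ∀ {n} → Digraph n → Set
IsDitree D = Irreflexive D × Connected D × Acyclic D

InClosedIn : ∀ {n} → Digraph n → Fin n → Fin n → Set
InClosedIn D z v = z ≡ v ⊎ Arc D z v

IsPacking : ∀ {n} → Digraph n → Subset n → Set
IsPacking D P = ∀ x y → x ∈ P → y ∈ P → x ≢ y →
                ∀ z → ¬ (InClosedIn D z x × InClosedIn D z y)

IsMaxPacking : ∀ {n} → Digraph n → Subset n → Set
IsMaxPacking D P = IsPacking D P × (∀ Q → IsPacking D Q → ∣ Q ∣ ≤ ∣ P ∣)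

Dominates : ∀ {n} → Digraph n → Subset n → Set
Dominates D S = ∀ v → v ∈ S ⊎ ∃ λ u → u ∈ S × Arc D u v

IsDomNumber : ∀ {n} → Digraph n → ℕ → Set
IsDomNumber D k = (∃ λ S → Dominates D S × ∣ S ∣ ≡ k)
                × (∀ S → Dominates D S → k ≤ ∣ S ∣)

DominatesUnderlying : ∀ {n} → Digraph n → Subset n → Set
DominatesUnderlying D S = ∀ v → v ∈ S ⊎ ∃ λ u → u ∈ S × Adj D u v

IsLeaf : ∀ {n} → Digraph n → Fin n → Set
IsLeaf D v = ∃ λ u → Adj D v u × (∀ w → Adj D v w → w ≡ u)

IsIsolatedLeaf : ∀ {n} → Digraph n → Fin n → Set
IsIsolatedLeaf D v = IsLeaf D v × (∀ u → ¬ Arc D u v)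

-- Cartesian product T₁ □ T₂ on Fin (n₁ * n₂), vertex x ↔ remQuot n₂ x = (a , b)
_□_ : ∀ {n₁ n₂} → Digraph n₁ → Digraph n₂ → Digraph (n₁ * n₂)
_□_ {n₁} {n₂} T₁ T₂ x y with remQuot {n₁} n₂ x | remQuot {n₁} n₂ y
... | (a₁ , b₁) | (a₂ , b₂) = (⌊ a₁ ≟ a₂ ⌋ ∧ T₂ b₁ b₂) ∨ (⌊ b₁ ≟ b₂ ⌋ ∧ T₁ a₁ a₂)

-- Peeling leaves off a ditree yields a packing P together with a dominating set of size at most ∣ P ∣,
-- so γ(Tᵢ) ≤ ∣ Pᵢ ∣ for every maximum packing Pᵢ. Let S be a minimum dominating set of T₁ □ T₂. The
-- dominator of a vertex (x , y) of P₁ × P₂ lies in N⁻[x] × N⁻[y], hence determines (x , y); since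
-- ∣ S ∣ = γ₁ γ₂ ≤ ∣ P₁ ∣ ∣ P₂ ∣, every element of S dominates some vertex of P₁ × P₂. So every vertex
-- (a , b) shares a closed in-neighbour c with some (x , y) ∈ P₁ × P₂. If P₁ does not dominate a in the
-- underlying graph, this forces every b into P₂, impossible because P₂ is independent and T₂ has an
-- arc. If a and b are sources, c can only be (a , b) itself, so a = x ∈ P₁ or b = y ∈ P₂: maximum
-- packings of T₁ and T₂ cannot both miss a source.
module Submission where

open import Defs
open import Data.Bool using (true; false; _∧_; _∨_)
import Data.Bool.Properties as Bool
open import Data.Empty using (⊥-elim)
open import Data.Fin using (Fin; zero; suc; remQuot; combine; quotRem; _≟_)
open import Data.Fin.Properties using (any?; all?; remQuot-combine; suc-injective)
open import Data.Fin.Subset using (Subset; _∈_; _∉_; ∣_∣; _-_; _∪_; ⁅_⁆; ⊤; ⊥; inside; outside)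
open import Data.Fin.Subset.Properties
  using ( _∈?_; ∉⊥; ∈⊤; ∣⊤∣≡n; ∣p∣≤n; ∣p∣≤∣x∷p∣; ∣⁅x⁆∣≡1; x∈⁅x⁆; x∈⁅y⁆⇒x≡y; p⊆p∪q; x∈p∪q⁺; x∈p∪q⁻
        ; x∈p∧x≢y⇒x∈p-y; x∈p⇒∣p-x∣<∣p∣; p⊂q⇒∣p∣<∣q∣; anySubset?)
open import Data.List using (List; []; _∷_; length; map; _++_; cartesianProduct)
open import Data.List.Properties using (length-map; length-++)
open import Data.List.Membership.Propositional using (find) renaming (_∈_ to _∈ₗ_)
open import Data.List.Membership.Propositional.Properties using (∈-map⁻; ∈-cartesianProduct⁻)
open import Data.List.Relation.Unary.All as All using (All; []; _∷_)
import Data.List.Relation.Unary.All.Properties as All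
open import Data.List.Relation.Unary.AllPairs using ([]; _∷_)
import Data.List.Relation.Unary.Any as Any
open import Data.List.Relation.Unary.Unique.Propositional using (Unique)
import Data.List.Relation.Unary.Unique.Propositional.Properties as Unique
open import Data.Nat using (ℕ; zero; suc; _≤_; _<_; _+_; _*_; z≤n; s≤s; _≤?_)
open import Data.Nat.Properties
  using ( ≤-refl; ≤-trans; ≤-reflexive; ≤-pred; <-≤-trans; <⇒≱; n≤1+n
        ; +-identityʳ; +-suc; +-comm; +-monoʳ-≤; *-mono-≤)
open import Data.Product using (∃; ∃₂; _×_; _,_; proj₁; proj₂)
import Data.Product as Product
open import Data.Sum using (_⊎_; inj₁; inj₂)
import Data.Sum as Sum
open import Data.Unit using (tt) renaming (⊤ to ⊤′)
open import Data.Vec using ([]; _∷_; here; there)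
open import Function using (id; _∘_)
open import Relation.Binary.PropositionalEquality using (_≡_; _≢_; refl; sym; trans; cong; cong₂; subst)
open import Relation.Nullary using (¬_; Dec; yes; no; contradiction)
open import Relation.Nullary.Decidable using (⌊_⌋; _×-dec_; _⊎-dec_; _→-dec_; ¬?; decidable-stable)
open import Relation.Unary using (Decidable)

Unique-++⁻ˡ : ∀ {A : Set} (xs : List A) {ys} → Unique (xs ++ ys) → Unique xs
Unique-++⁻ˡ []       _          = []
Unique-++⁻ˡ (x ∷ xs) (x∉ ∷ xs!) = All.++⁻ˡ xs x∉ ∷ Unique-++⁻ˡ xs xs!

length-cartesianProduct : ∀ {A B : Set} (xs : List A) (ys : List B) →
                          length (cartesianProduct xs ys) ≡ length xs * length ys
length-cartesianProduct []       ys = refl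
length-cartesianProduct (x ∷ xs) ys =
  trans (length-++ (map (x ,_) ys)) (cong₂ _+_ (length-map (x ,_) ys) (length-cartesianProduct xs ys))

members : ∀ {n} → Subset n → List (Fin n)
members []            = []
members (inside  ∷ p) = zero ∷ map suc (members p)
members (outside ∷ p) = map suc (members p)

length-members : ∀ {n} (p : Subset n) → length (members p) ≡ ∣ p ∣
length-members []            = refl
length-members (inside  ∷ p) = cong suc (trans (length-map suc (members p)) (length-members p))
length-members (outside ∷ p) = trans (length-map suc (members p)) (length-members p)

members-unique : ∀ {n} (p : Subset n) → Unique (members p)
members-unique []            = []
members-unique (inside  ∷ p) =
  All.map⁺ (All.universal (λ _ ()) (members p)) ∷ Unique.map⁺ suc-injective (members-unique p)
members-unique (outside ∷ p) = Unique.map⁺ suc-injective (members-unique p)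

∈-members⁻ : ∀ {n} {x : Fin n} (p : Subset n) → x ∈ₗ members p → x ∈ p
∈-members⁻ (inside  ∷ p) (Any.here refl) = here
∈-members⁻ (inside  ∷ p) (Any.there x∈) with ∈-map⁻ suc x∈
... | y , y∈ , refl = there (∈-members⁻ p y∈)
∈-members⁻ (outside ∷ p) x∈ with ∈-map⁻ suc x∈
... | y , y∈ , refl = there (∈-members⁻ p y∈)

∣p∪q∣≤∣p∣+∣q∣ : ∀ {n} (p q : Subset n) → ∣ p ∪ q ∣ ≤ ∣ p ∣ + ∣ q ∣
∣p∪q∣≤∣p∣+∣q∣ []            []            = z≤n
∣p∪q∣≤∣p∣+∣q∣ (inside  ∷ p) (s       ∷ q) =
  s≤s (≤-trans (∣p∪q∣≤∣p∣+∣q∣ p q) (+-monoʳ-≤ ∣ p ∣ (∣p∣≤∣x∷p∣ s q)))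
∣p∪q∣≤∣p∣+∣q∣ (outside ∷ p) (inside  ∷ q) =
  ≤-trans (s≤s (∣p∪q∣≤∣p∣+∣q∣ p q)) (≤-reflexive (sym (+-suc ∣ p ∣ ∣ q ∣)))
∣p∪q∣≤∣p∣+∣q∣ (outside ∷ p) (outside ∷ q) = ∣p∪q∣≤∣p∣+∣q∣ p q

∣p∪⁅x⁆∣≤1+∣p∣ : ∀ {n} (p : Subset n) x → ∣ p ∪ ⁅ x ⁆ ∣ ≤ suc ∣ p ∣
∣p∪⁅x⁆∣≤1+∣p∣ p x =
  ≤-trans (∣p∪q∣≤∣p∣+∣q∣ p ⁅ x ⁆) (≤-reflexive (trans (cong (∣ p ∣ +_) (∣⁅x⁆∣≡1 x)) (+-comm ∣ p ∣ 1)))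

x∉p⇒∣p∣<∣p∪⁅x⁆∣ : ∀ {n} {p : Subset n} {x} → x ∉ p → ∣ p ∣ < ∣ p ∪ ⁅ x ⁆ ∣
x∉p⇒∣p∣<∣p∪⁅x⁆∣ {x = x} x∉p = p⊂q⇒∣p∣<∣q∣ (p⊆p∪q ⁅ x ⁆ , x , x∈p∪q⁺ (inj₂ (x∈⁅x⁆ x)) , x∉p)

x∈p∪⁅y⁆⁻ : ∀ {n} {x : Fin n} (p : Subset n) y → x ∈ p ∪ ⁅ y ⁆ → x ∈ p ⊎ x ≡ y
x∈p∪⁅y⁆⁻ p y x∈ = Sum.map₂ (x∈⁅y⁆⇒x≡y y) (x∈p∪q⁻ p ⁅ y ⁆ x∈)

allSubsets? : ∀ {n} {R : Subset n → Set} → Decidable R → Dec (∀ Q → R Q)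
allSubsets? R? with anySubset? (λ Q → ¬? (R? Q))
... | yes (Q , ¬RQ) = no λ ∀R → ¬RQ (∀R Q)
... | no ¬∃        = yes λ Q → decidable-stable (R? Q) λ ¬RQ → ¬∃ (Q , ¬RQ)

module _ {X : Set} {m} (f : X → Fin m) where

  InjectiveOn : List X → Set
  InjectiveOn xs = ∀ {x y} → x ∈ₗ xs → y ∈ₗ xs → f x ≡ f y → x ≡ y

  length≤∣image∣ : ∀ {B} xs → Unique xs → (∀ {x} → x ∈ₗ xs → f x ∈ B) → InjectiveOn xs → length xs ≤ ∣ B ∣
  length≤∣image∣     []       _          _   _   = z≤n
  length≤∣image∣ {B} (x ∷ xs) (x∉ ∷ xs!) f∈B inj =
    <-≤-trans (s≤s (length≤∣image∣ xs xs! f∈B-fx (λ p q → inj (Any.there p) (Any.there q))))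
              (x∈p⇒∣p-x∣<∣p∣ (f∈B (Any.here refl)))
    where
    f∈B-fx : ∀ {y} → y ∈ₗ xs → f y ∈ B - f x
    f∈B-fx y∈ = x∈p∧x≢y⇒x∈p-y (f∈B (Any.there y∈))
      (λ fy≡fx → All.lookup x∉ y∈ (inj (Any.here refl) (Any.there y∈) (sym fy≡fx)))

  injective⇒surjective : ∀ {B} xs → Unique xs → (∀ {x} → x ∈ₗ xs → f x ∈ B) → InjectiveOn xs
    → ∣ B ∣ ≤ length xs → ∀ {b} → b ∈ B → ∃ λ x → x ∈ₗ xs × f x ≡ b
  injective⇒surjective {B} xs xs! f∈B inj ∣B∣≤ {b} b∈B with Any.any? (λ x → f x ≟ b) xs
  ... | yes hit = find hit
  ... | no miss =
    contradiction ∣B∣≤ (<⇒≱ (<-≤-trans (s≤s (length≤∣image∣ xs xs! f∈B-b inj)) (x∈p⇒∣p-x∣<∣p∣ b∈B)))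
    where
    f∈B-b : ∀ {x} → x ∈ₗ xs → f x ∈ B - b
    f∈B-b x∈ = x∈p∧x≢y⇒x∈p-y (f∈B x∈) (λ fx≡b → miss (Any.map (λ { refl → fx≡b }) x∈))

-- Defs states the closing edge of a cycle through a where-bound function; LastFactor names its type.
LastFactor : {A B C L : Set} → (A × B × C × L) ≡ (A × B × C × L) → Set
LastFactor {L = L} _ = L

Source : ∀ {n} → Digraph n → Fin n → Set
Source D v = ∀ u → ¬ Arc D u v

module _ {n} (D : Digraph n) where

  arc? : ∀ u v → Dec (Arc D u v)
  arc? u v = D u v Bool.≟ true

  adj? : ∀ u v → Dec (Adj D u v)
  adj? u v = arc? u v ⊎-dec arc? v u

  inClosedIn? : ∀ z v → Dec (InClosedIn D z v)
  inClosedIn? z v = (z ≟ v) ⊎-dec arc? z v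

  source? : ∀ v → Dec (Source D v)
  source? v = all? λ u → ¬? (arc? u v)

  isPacking? : ∀ P → Dec (IsPacking D P)
  isPacking? P = all? λ x → all? λ y → (x ∈? P) →-dec (y ∈? P) →-dec ¬? (x ≟ y) →-dec
    all? λ z → ¬? (inClosedIn? z x ×-dec inClosedIn? z y)

  isMaxPacking? : ∀ P → Dec (IsMaxPacking D P)
  isMaxPacking? P = isPacking? P ×-dec allSubsets? λ Q → isPacking? Q →-dec ∣ Q ∣ ≤? ∣ P ∣

  ¬arc-self : Irreflexive D → ∀ {u} → ¬ Arc D u u
  ¬arc-self irr {u} uu with trans (sym uu) (irr u)
  ... | ()

  source-inClosedIn : ∀ {z v} → Source D v → InClosedIn D z v → z ≡ v
  source-inClosedIn _   (inj₁ z≡v) = z≡v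
  source-inClosedIn src (inj₂ zv)  = contradiction zv (src _)

  dominator : ∀ {S} → Dominates D S → ∀ v → ∃ λ u → u ∈ S × InClosedIn D u v
  dominator dom v with dom v
  ... | inj₁ v∈S            = v , v∈S , inj₁ refl
  ... | inj₂ (u , u∈S , uv) = u , u∈S , inj₂ uv

  module _ {P : Subset n} (pk : IsPacking D P) where

    packing-≡ : ∀ {x y z} → x ∈ P → y ∈ P → InClosedIn D z x → InClosedIn D z y → x ≡ y
    packing-≡ {x} {y} {z} x∈P y∈P zx zy with x ≟ y
    ... | yes x≡y = x≡y
    ... | no  x≢y = contradiction (zx , zy) (pk x y x∈P y∈P x≢y z)

    packing-independent : Irreflexive D → ∀ {u w} → u ∈ P → w ∈ P → ¬ Arc D u w
    packing-independent irr u∈P w∈P uw with packing-≡ u∈P w∈P (inj₁ refl) (inj₂ uw)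
    ... | refl = ¬arc-self irr uw

  connected⇒arc : 2 ≤ n → Connected D → ∃₂ (Arc D)
  connected⇒arc (s≤s (s≤s _)) con with con zero (suc zero)
  ... | step (inj₁ uw) _ = _ , _ , uw
  ... | step (inj₂ wu) _ = _ , _ , wu

  ClosedBy : Fin n → List (Fin n) → Set
  ClosedBy v₀ []           = ⊤′
  ClosedBy v₀ (x ∷ [])     = Adj D x v₀
  ClosedBy v₀ (x ∷ y ∷ ys) = ClosedBy v₀ (y ∷ ys)

  isCycle : ∀ v₀ vs → 3 ≤ length (v₀ ∷ vs) → Unique (v₀ ∷ vs) → Chain D (v₀ ∷ vs) → ClosedBy v₀ vs
    → IsCycle D v₀ vs
  isCycle v₀ vs long distinct chain closed = long , distinct , chain , closing vs closed
    where
    closing : ∀ vs → ClosedBy v₀ vs → LastFactor (refl {x = IsCycle D v₀ vs})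
    closing []           c = c
    closing (x ∷ [])     c = c
    closing (x ∷ y ∷ ys) c = closing (y ∷ ys) c

  Chain-++⁻ˡ : ∀ xs {ys} → Chain D (xs ++ ys) → Chain D xs
  Chain-++⁻ˡ []           _        = tt
  Chain-++⁻ˡ (x ∷ [])     _        = tt
  Chain-++⁻ˡ (x ∷ y ∷ xs) (a , ch) = a , Chain-++⁻ˡ (y ∷ xs) ch

  takeThrough : ∀ {x} xs → x ∈ₗ xs → List (Fin n)
  takeThrough (y ∷ xs) (Any.here _)  = y ∷ []
  takeThrough (y ∷ xs) (Any.there p) = y ∷ takeThrough xs p

  takeThrough-++ : ∀ {x} xs (p : x ∈ₗ xs) → ∃ λ rest → takeThrough xs p ++ rest ≡ xs
  takeThrough-++ (y ∷ xs) (Any.here _)  = xs , refl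
  takeThrough-++ (y ∷ xs) (Any.there p) = Product.map₂ (cong (y ∷_)) (takeThrough-++ xs p)

  length-takeThrough : ∀ {x} xs (p : x ∈ₗ xs) → 1 ≤ length (takeThrough xs p)
  length-takeThrough (_ ∷ _) (Any.here _)  = s≤s z≤n
  length-takeThrough (_ ∷ _) (Any.there _) = s≤s z≤n

  closedBy-takeThrough : ∀ {v₀ x} y xs (p : x ∈ₗ xs) → Adj D x v₀ → ClosedBy v₀ (y ∷ takeThrough xs p)
  closedBy-takeThrough y (x ∷ xs) (Any.here refl) xv₀ = xv₀
  closedBy-takeThrough y (z ∷ xs) (Any.there p)   xv₀ = closedBy-takeThrough z xs p xv₀

  LeafIn : Subset n → Fin n → Set
  LeafIn A ℓ = ∀ {u w} → u ∈ A → w ∈ A → Adj D ℓ u → Adj D ℓ w → u ≡ w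

  IsPackingIn : Subset n → Subset n → Set
  IsPackingIn A P = ∀ {x y z} → x ∈ P → y ∈ P → x ≢ y → z ∈ A → ¬ (InClosedIn D z x × InClosedIn D z y)

  DominatesAll : (Fin n → Set) → Subset n → Set
  DominatesAll W S = ∀ {w} → W w → ∃ λ d → d ∈ S × InClosedIn D d w

  -- the invariant of leaf peeling: A is what remains of the forest, W ⊆ A what remains to be dominated
  record PackingAndDominatingSet (A : Subset n) (W : Fin n → Set) : Set where
    field
      packing               : Subset n
      dominatingSet         : Subset n
      packing⊆W             : ∀ {x} → x ∈ packing → W x
      isPackingIn           : IsPackingIn A packing
      dominates             : DominatesAll W dominatingSet
      ∣dominating∣≤∣packing∣ : ∣ dominatingSet ∣ ≤ ∣ packing ∣

  -- c is ℓ's in-neighbour in A if it has one, and ℓ itself otherwise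
  record Anchor (A : Subset n) (ℓ c : Fin n) : Set where
    field
      dominatesLeaf : InClosedIn D c ℓ
      inNeighbours  : ∀ {z} → z ∈ A → InClosedIn D z ℓ → z ≡ ℓ ⊎ z ≡ c
      outNeighbours : ∀ {y} → y ∈ A → Arc D ℓ y → InClosedIn D c y

  Undominated : (Fin n → Set) → Fin n → Fin n → Fin n → Set
  Undominated W ℓ c w = W w × w ≢ ℓ × ¬ InClosedIn D c w

  packingIn-∪⁅⁆ : ∀ {A P ℓ} → IsPackingIn A P
    → (∀ {y z} → y ∈ P → z ∈ A → ¬ (InClosedIn D z ℓ × InClosedIn D z y)) → IsPackingIn A (P ∪ ⁅ ℓ ⁆)
  packingIn-∪⁅⁆ {P = P} {ℓ} pk apart x∈ y∈ x≢y z∈A (zx , zy)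
    with x∈p∪⁅y⁆⁻ P ℓ x∈ | x∈p∪⁅y⁆⁻ P ℓ y∈
  ... | inj₁ x∈P  | inj₁ y∈P  = pk x∈P y∈P x≢y z∈A (zx , zy)
  ... | inj₁ x∈P  | inj₂ refl = apart x∈P z∈A (zy , zx)
  ... | inj₂ refl | inj₁ y∈P  = apart y∈P z∈A (zx , zy)
  ... | inj₂ refl | inj₂ refl = x≢y refl

  module _ {A : Subset n} {ℓ : Fin n} (leaf : LeafIn A ℓ) where

    anchor : ∃ (Anchor A ℓ)
    anchor with any? (λ p → (p ∈? A) ×-dec arc? p ℓ)
    ... | yes (p , p∈A , pℓ) = p , record
      { dominatesLeaf = inj₂ pℓ
      ; inNeighbours  = λ { _ (inj₁ z≡ℓ) → inj₁ z≡ℓ ; z∈A (inj₂ zℓ) → inj₂ (leaf z∈A p∈A (inj₂ zℓ) (inj₂ pℓ)) }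
      ; outNeighbours = λ y∈A ℓy → inj₁ (sym (leaf y∈A p∈A (inj₁ ℓy) (inj₂ pℓ)))
      }
    ... | no noInNeighbour = ℓ , record
      { dominatesLeaf = inj₁ refl
      ; inNeighbours  = λ { _ (inj₁ z≡ℓ) → inj₁ z≡ℓ ; z∈A (inj₂ zℓ) → ⊥-elim (noInNeighbour (_ , z∈A , zℓ)) }
      ; outNeighbours = λ _ ℓy → inj₂ ℓy
      }

    packingIn-withLeaf : ∀ {P} → ℓ ∉ P → (∀ {x} → x ∈ P → x ∈ A) → IsPackingIn (A - ℓ) P → IsPackingIn A P
    packingIn-withLeaf ℓ∉P P⊆A pk {x} {y} {z} x∈P y∈P x≢y z∈A with z ≟ ℓ
    ... | no  z≢ℓ  = pk x∈P y∈P x≢y (x∈p∧x≢y⇒x∈p-y z∈A z≢ℓ)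
    ... | yes refl = λ
      { (inj₁ refl , _)      → ℓ∉P x∈P
      ; (_ , inj₁ refl)      → ℓ∉P y∈P
      ; (inj₂ ℓx , inj₂ ℓy) → x≢y (leaf (P⊆A x∈P) (P⊆A y∈P) (inj₁ ℓx) (inj₁ ℓy))
      }

    module _ {W : Fin n → Set} (W⊆A : ∀ {w} → W w → w ∈ A) where

      skipLeaf : ¬ W ℓ → PackingAndDominatingSet (A - ℓ) W → PackingAndDominatingSet A W
      skipLeaf ¬Wℓ rec = record
        { packing               = packing
        ; dominatingSet         = dominatingSet
        ; packing⊆W             = packing⊆W
        ; isPackingIn           = packingIn-withLeaf (¬Wℓ ∘ packing⊆W) (W⊆A ∘ packing⊆W) isPackingIn
        ; dominates             = dominates
        ; ∣dominating∣≤∣packing∣ = ∣dominating∣≤∣packing∣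
        }
        where open PackingAndDominatingSet rec

      takeLeaf : ∀ {c} → W ℓ → Anchor A ℓ c → PackingAndDominatingSet (A - ℓ) (Undominated W ℓ c)
        → PackingAndDominatingSet A W
      takeLeaf {c} Wℓ anc rec = record
        { packing               = packing ∪ ⁅ ℓ ⁆
        ; dominatingSet         = dominatingSet ∪ ⁅ c ⁆
        ; packing⊆W             = λ x∈ → Sum.[ proj₁ ∘ packing⊆W , (λ { refl → Wℓ }) ] (x∈p∪⁅y⁆⁻ packing ℓ x∈)
        ; isPackingIn           =
            packingIn-∪⁅⁆ (packingIn-withLeaf ℓ∉ (W⊆A ∘ proj₁ ∘ packing⊆W) isPackingIn) apart
        ; dominates             = dominates′
        ; ∣dominating∣≤∣packing∣ =
            ≤-trans (∣p∪⁅x⁆∣≤1+∣p∣ dominatingSet c) (≤-trans (s≤s ∣dominating∣≤∣packing∣) (x∉p⇒∣p∣<∣p∪⁅x⁆∣ ℓ∉))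
        }
        where
        open PackingAndDominatingSet rec
        open Anchor anc
        ℓ∉ : ℓ ∉ packing
        ℓ∉ ℓ∈ = proj₁ (proj₂ (packing⊆W ℓ∈)) refl
        apart : ∀ {y z} → y ∈ packing → z ∈ A → ¬ (InClosedIn D z ℓ × InClosedIn D z y)
        apart y∈ z∈A (zℓ , zy) with packing⊆W y∈ | inNeighbours z∈A zℓ
        ... | _  , _   , ¬cy | inj₂ refl = ¬cy zy
        ... | Wy , y≢ℓ , ¬cy | inj₁ refl =
          Sum.[ (λ ℓ≡y → y≢ℓ (sym ℓ≡y)) , (λ ℓy → ¬cy (outNeighbours (W⊆A Wy) ℓy)) ] zy
        c∈ : c ∈ dominatingSet ∪ ⁅ c ⁆
        c∈ = x∈p∪q⁺ (inj₂ (x∈⁅x⁆ c))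
        dominates′ : DominatesAll W (dominatingSet ∪ ⁅ c ⁆)
        dominates′ {w} Ww with w ≟ ℓ | inClosedIn? c w
        ... | yes refl | _      = c , c∈ , dominatesLeaf
        ... | no _     | yes cw = c , c∈ , cw
        ... | no w≢ℓ   | no ¬cw with dominates (Ww , w≢ℓ , ¬cw)
        ...   | d , d∈ , dw = d , x∈p∪q⁺ (inj₁ d∈) , dw

  module Forest (irr : Irreflexive D) (acyc : Acyclic D) where

    open import Data.List.Membership.DecPropositional (_≟_ {n}) using () renaming (_∈?_ to _∈ₗ?_)

    ¬adj-self : ∀ {u} → ¬ Adj D u u
    ¬adj-self = Sum.[ ¬arc-self irr , ¬arc-self irr ]

    onPath⇒next : ∀ {u} h a r → Unique (h ∷ a ∷ r) → Chain D (h ∷ a ∷ r) → Adj D h u → u ∈ₗ h ∷ a ∷ r → u ≡ a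
    onPath⇒next h a r _        _     hu (Any.here refl)             = ⊥-elim (¬adj-self hu)
    onPath⇒next h a r _        _     hu (Any.there (Any.here refl)) = refl
    onPath⇒next h a r distinct chain hu (Any.there (Any.there p))   =
      ⊥-elim (acyc h cycle (isCycle h cycle (s≤s (s≤s (length-takeThrough r p)))
        (Unique-++⁻ˡ (h ∷ cycle) (subst (λ l → Unique (h ∷ a ∷ l)) (sym r≡) distinct))
        (Chain-++⁻ˡ (h ∷ cycle) (subst (λ l → Chain D (h ∷ a ∷ l)) (sym r≡) chain))
        (closedBy-takeThrough a r p (Sum.swap hu))))
      where
      cycle = a ∷ takeThrough r p
      r≡ = proj₂ (takeThrough-++ r p)

    module _ {A : Subset n} where

      pathEnd-leaf : ∀ h t → Unique (h ∷ t) → Chain D (h ∷ t) → (∀ {u} → u ∈ A → Adj D h u → u ∈ₗ h ∷ t)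
        → LeafIn A h
      pathEnd-leaf h []      _        _     onPath u∈A _ hu _ with onPath u∈A hu
      ... | Any.here refl = ⊥-elim (¬adj-self hu)
      pathEnd-leaf h (a ∷ r) distinct chain onPath u∈A w∈A hu hw = trans (next u∈A hu) (sym (next w∈A hw))
        where
        next : ∀ {u} → u ∈ A → Adj D h u → u ≡ a
        next u∈A hu = onPath⇒next h a r distinct chain hu (onPath u∈A hu)

      -- the path h ∷ t is kept with its newest vertex first; k bounds how often it can still grow
      growPath : ∀ k h t → n < length (h ∷ t) + k → Unique (h ∷ t) → Chain D (h ∷ t) → All (_∈ A) (h ∷ t)
        → ∃ λ ℓ → ℓ ∈ A × LeafIn A ℓ
      growPath zero h t long distinct _ _ =
        contradiction (≤-trans (length≤∣image∣ id (h ∷ t) distinct (λ _ → ∈⊤) (λ _ _ → id))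
                               (≤-reflexive (∣⊤∣≡n n)))
                      (<⇒≱ (subst (n <_) (+-identityʳ _) long))
      growPath (suc k) h t long distinct chain inA
        with any? (λ u → (u ∈? A) ×-dec adj? h u ×-dec ¬? (u ∈ₗ? h ∷ t))
      ... | yes (u , u∈A , hu , u∉) =
        growPath k u (h ∷ t) (subst (n <_) (+-suc _ k) long) (All.¬Any⇒All¬ (h ∷ t) u∉ ∷ distinct)
          (Sum.swap hu , chain) (u∈A ∷ inA)
      ... | no stuck = h , All.head inA , pathEnd-leaf h t distinct chain onPath
        where
        onPath : ∀ {u} → u ∈ A → Adj D h u → u ∈ₗ h ∷ t
        onPath {u} u∈A hu = decidable-stable (u ∈ₗ? h ∷ t) λ u∉ → stuck (u , u∈A , hu , u∉)

      findLeaf : ∀ {x} → x ∈ A → ∃ λ ℓ → ℓ ∈ A × LeafIn A ℓ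
      findLeaf {x} x∈A = growPath n x [] ≤-refl ([] ∷ []) tt (x∈A ∷ [])

    stripLeaves : ∀ k {A} → ∣ A ∣ ≤ k → {W : Fin n → Set} → Decidable W → (∀ {w} → W w → w ∈ A)
      → PackingAndDominatingSet A W
    stripLeaves k {A} ∣A∣≤k W? W⊆A with any? (_∈? A)
    ... | no empty = record
      { packing               = ⊥
      ; dominatingSet         = ⊥
      ; packing⊆W             = λ x∈ → contradiction x∈ ∉⊥
      ; isPackingIn           = λ x∈ → contradiction x∈ ∉⊥
      ; dominates             = λ Ww → ⊥-elim (empty (_ , W⊆A Ww))
      ; ∣dominating∣≤∣packing∣ = ≤-refl
      }
    stripLeaves zero    ∣A∣≤0 W? W⊆A | yes (x , x∈A) =
      contradiction ∣A∣≤0 (<⇒≱ (≤-trans (s≤s z≤n) (x∈p⇒∣p-x∣<∣p∣ x∈A)))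
    stripLeaves (suc k) {A} ∣A∣≤1+k {W} W? W⊆A | yes (x , x∈A) = strip (findLeaf x∈A)
      where
      ∣A-ℓ∣≤k : ∀ {ℓ} → ℓ ∈ A → ∣ A - ℓ ∣ ≤ k
      ∣A-ℓ∣≤k ℓ∈A = ≤-pred (≤-trans (x∈p⇒∣p-x∣<∣p∣ ℓ∈A) ∣A∣≤1+k)
      strip : (∃ λ ℓ → ℓ ∈ A × LeafIn A ℓ) → PackingAndDominatingSet A W
      strip (ℓ , ℓ∈A , leaf) with W? ℓ
      ... | no ¬Wℓ = skipLeaf leaf W⊆A ¬Wℓ
        (stripLeaves k (∣A-ℓ∣≤k ℓ∈A) W? λ Ww → x∈p∧x≢y⇒x∈p-y (W⊆A Ww) λ { refl → ¬Wℓ Ww })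
      ... | yes Wℓ with anchor leaf
      ...   | c , anc = takeLeaf leaf W⊆A Wℓ anc
        (stripLeaves k (∣A-ℓ∣≤k ℓ∈A) W′? λ (Ww , w≢ℓ , _) → x∈p∧x≢y⇒x∈p-y (W⊆A Ww) w≢ℓ)
        where
        W′? : Decidable (Undominated W ℓ c)
        W′? w = W? w ×-dec ¬? (w ≟ ℓ) ×-dec ¬? (inClosedIn? c w)

    domNumber≤∣maxPacking∣ : ∀ {γ P} → IsDomNumber D γ → IsMaxPacking D P → γ ≤ ∣ P ∣
    domNumber≤∣maxPacking∣ (_ , minimal) (_ , maximal) =
      ≤-trans (minimal dominatingSet dominates′) (≤-trans ∣dominating∣≤∣packing∣ (maximal packing isPacking))
      where
      open PackingAndDominatingSet (stripLeaves n (∣p∣≤n ⊤) (_∈? ⊤) id)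
      isPacking : IsPacking D packing
      isPacking x y x∈ y∈ x≢y z = isPackingIn x∈ y∈ x≢y ∈⊤
      dominates′ : Dominates D dominatingSet
      dominates′ v with dominates (∈⊤ {x = v})
      ... | d , d∈ , inj₁ refl = inj₁ d∈
      ... | d , d∈ , inj₂ dv   = inj₂ (d , d∈ , dv)

∧∨∧≡true⁻ : ∀ {A B : Set} (a? : Dec A) (b? : Dec B) {x y} → (⌊ a? ⌋ ∧ x) ∨ (⌊ b? ⌋ ∧ y) ≡ true
  → (A × x ≡ true) ⊎ (B × y ≡ true)
∧∨∧≡true⁻ (yes a) _       {true}          _  = inj₁ (a , refl)
∧∨∧≡true⁻ _       (yes b) {y = true}      _  = inj₂ (b , refl)
∧∨∧≡true⁻ (yes _) (yes _) {false} {false} ()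
∧∨∧≡true⁻ (yes _) (no _)  {false}         ()
∧∨∧≡true⁻ (no _)  (yes _) {y = false}     ()
∧∨∧≡true⁻ (no _)  (no _)                  ()

module _ {n₁ n₂} (T₁ : Digraph n₁) (T₂ : Digraph n₂) where

  InClosedIn□ : Fin n₁ × Fin n₂ → Fin n₁ × Fin n₂ → Set
  InClosedIn□ (a , b) (x , y) = (a ≡ x × InClosedIn T₂ b y) ⊎ (InClosedIn T₁ a x × b ≡ y)

  □-arc⁻ : ∀ {s t} → Arc (T₁ □ T₂) s t → InClosedIn□ (remQuot n₂ s) (remQuot n₂ t)
  □-arc⁻ {s} {t} st with quotRem {n₁} n₂ s | quotRem {n₁} n₂ t
  ... | b₁ , a₁ | b₂ , a₂ =
    Sum.map (Product.map₂ inj₂) (λ (b₁≡b₂ , a₁a₂) → inj₂ a₁a₂ , b₁≡b₂) (∧∨∧≡true⁻ (a₁ ≟ a₂) (b₁ ≟ b₂) st)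

  □-inClosedIn⁻ : ∀ {s x y} → InClosedIn (T₁ □ T₂) s (combine x y) → InClosedIn□ (remQuot n₂ s) (x , y)
  □-inClosedIn⁻ {s} {x} {y} = subst (InClosedIn□ (remQuot n₂ s)) (remQuot-combine x y) ∘ inCoordinates
    where
    inCoordinates : ∀ {t} → InClosedIn (T₁ □ T₂) s t → InClosedIn□ (remQuot n₂ s) (remQuot n₂ t)
    inCoordinates (inj₁ refl) = inj₁ (refl , inj₁ refl)
    inCoordinates (inj₂ st)   = □-arc⁻ st

  InClosedIn□⇒× : ∀ {a b x y} → InClosedIn□ (a , b) (x , y) → InClosedIn T₁ a x × InClosedIn T₂ b y
  InClosedIn□⇒× (inj₁ (refl , by)) = inj₁ refl , by
  InClosedIn□⇒× (inj₂ (ax , refl)) = ax , inj₁ refl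

  CoveredBy : Subset n₁ → Subset n₂ → Fin n₁ → Fin n₂ → Set
  CoveredBy P₁ P₂ a b = ∃ λ c → InClosedIn□ c (a , b) × ∃₂ λ x y → x ∈ P₁ × y ∈ P₂ × InClosedIn□ c (x , y)

  ProductCovering : Subset n₁ → Subset n₂ → Set
  ProductCovering P₁ P₂ = ∀ a b → CoveredBy P₁ P₂ a b

  productCovering : ∀ {P₁ P₂ S} → IsPacking T₁ P₁ → IsPacking T₂ P₂ → Dominates (T₁ □ T₂) S
    → ∣ S ∣ ≤ ∣ P₁ ∣ * ∣ P₂ ∣ → ProductCovering P₁ P₂
  productCovering {P₁} {P₂} {S} pk₁ pk₂ dom ∣S∣≤ a b =
    remQuot n₂ (d (a , b)) , d-dominates (a , b) ,
    proj₁ q , proj₂ q , proj₁ (∈pairs⁻ q∈) , proj₂ (∈pairs⁻ q∈) ,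
    subst (λ s → InClosedIn□ (remQuot n₂ s) q) dq≡ (d-dominates q)
    where
    d : Fin n₁ × Fin n₂ → Fin (n₁ * n₂)
    d (x , y) = proj₁ (dominator (T₁ □ T₂) dom (combine x y))
    d∈S : ∀ q → d q ∈ S
    d∈S (x , y) = proj₁ (proj₂ (dominator (T₁ □ T₂) dom (combine x y)))
    d-dominates : ∀ q → InClosedIn□ (remQuot n₂ (d q)) q
    d-dominates (x , y) = □-inClosedIn⁻ (proj₂ (proj₂ (dominator (T₁ □ T₂) dom (combine x y))))
    pairs = cartesianProduct (members P₁) (members P₂)
    ∈pairs⁻ : ∀ {q} → q ∈ₗ pairs → proj₁ q ∈ P₁ × proj₂ q ∈ P₂
    ∈pairs⁻ q∈ = Product.map (∈-members⁻ P₁) (∈-members⁻ P₂) (∈-cartesianProduct⁻ _ _ q∈)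
    ∣S∣≤∣pairs∣ : ∣ S ∣ ≤ length pairs
    ∣S∣≤∣pairs∣ = ≤-trans ∣S∣≤ (≤-reflexive (sym (trans (length-cartesianProduct (members P₁) (members P₂))
                                                        (cong₂ _*_ (length-members P₁) (length-members P₂)))))
    d-injective : InjectiveOn d pairs
    d-injective {x , y} {x′ , y′} q∈ q′∈ dq≡dq′ =
      cong₂ _,_ (packing-≡ T₁ pk₁ (proj₁ (∈pairs⁻ q∈)) (proj₁ (∈pairs⁻ q′∈)) (proj₁ cell) (proj₁ cell′))
                (packing-≡ T₂ pk₂ (proj₂ (∈pairs⁻ q∈)) (proj₂ (∈pairs⁻ q′∈)) (proj₂ cell) (proj₂ cell′))
      where
      cell  = InClosedIn□⇒× (d-dominates (x , y))
      cell′ = InClosedIn□⇒×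
        (subst (λ s → InClosedIn□ (remQuot n₂ s) (x′ , y′)) (sym dq≡dq′) (d-dominates (x′ , y′)))
    preimage = injective⇒surjective d pairs (Unique.cartesianProduct⁺ (members-unique P₁) (members-unique P₂))
                 (λ {q} _ → d∈S q) d-injective ∣S∣≤∣pairs∣ (d∈S (a , b))
    q   = proj₁ preimage
    q∈  = proj₁ (proj₂ preimage)
    dq≡ = proj₂ (proj₂ preimage)

  module _ {P₁ P₂} (cover : ProductCovering P₁ P₂) where

    covering⇒full : ∀ {v} → v ∉ P₁ → (∀ {u} → u ∈ P₁ → ¬ Adj T₁ u v) → ∀ b → b ∈ P₂
    covering⇒full {v} v∉ far b = fromCover (cover v b)
      where
      v∉N⁻[_] : ∀ {x} → x ∈ P₁ → ¬ InClosedIn T₁ v x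
      v∉N⁻[ x∈ ] (inj₁ refl) = v∉ x∈
      v∉N⁻[ x∈ ] (inj₂ vx)   = far x∈ (inj₂ vx)
      ∉N⁻[v] : ∀ {x} → x ∈ P₁ → ¬ InClosedIn T₁ x v
      ∉N⁻[v] x∈ (inj₁ refl) = v∉ x∈
      ∉N⁻[v] x∈ (inj₂ xv)   = far x∈ (inj₁ xv)
      fromCover : CoveredBy P₁ P₂ v b → b ∈ P₂
      fromCover (_ , inj₁ (refl , _)   , _ , _ , x∈ , _  , cxy)             =
        ⊥-elim (v∉N⁻[ x∈ ] (proj₁ (InClosedIn□⇒× cxy)))
      fromCover (_ , inj₂ (c₁v , refl) , _ , _ , x∈ , _  , inj₁ (refl , _)) = ⊥-elim (∉N⁻[v] x∈ c₁v)
      fromCover (_ , inj₂ (_ , refl)   , _ , _ , _  , y∈ , inj₂ (_ , refl)) = y∈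

    covering⇒dominatesUnderlying : Irreflexive T₂ → ∃₂ (Arc T₂) → IsPacking T₂ P₂ → DominatesUnderlying T₁ P₁
    covering⇒dominatesUnderlying irr₂ (u , w , uw) pk₂ v with v ∈? P₁
    ... | yes v∈ = inj₁ v∈
    ... | no  v∉ with any? (λ u → (u ∈? P₁) ×-dec adj? T₁ u v)
    ...   | yes near = inj₂ near
    ...   | no ¬near = ⊥-elim (packing-independent T₂ pk₂ irr₂ (full u) (full w) uw)
      where full = covering⇒full v∉ (λ u∈ uv → ¬near (_ , u∈ , uv))

    covering⇒sources : ∀ {v w} → Source T₁ v → Source T₂ w → v ∈ P₁ ⊎ w ∈ P₂
    covering⇒sources {v} {w} src₁ src₂ = fromCover (cover v w)
      where
      isSource : ∀ {c₁ c₂} → InClosedIn□ (c₁ , c₂) (v , w) → c₁ ≡ v × c₂ ≡ w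
      isSource (inj₁ (c₁≡v , c₂w)) = c₁≡v , source-inClosedIn T₂ src₂ c₂w
      isSource (inj₂ (c₁v , c₂≡w)) = source-inClosedIn T₁ src₁ c₁v , c₂≡w
      fromCover : CoveredBy P₁ P₂ v w → v ∈ P₁ ⊎ w ∈ P₂
      fromCover (_ , cvw , x , y , x∈ , y∈ , cxy) with isSource cvw
      ... | refl , refl = Sum.map (λ { (refl , _) → x∈ }) (λ { (_ , refl) → y∈ }) cxy

module _ {n₁ n₂} (T₁ : Digraph n₁) (T₂ : Digraph n₂) where

  InClosedIn□-swap : ∀ {c a b} → InClosedIn□ T₁ T₂ c (a , b) → InClosedIn□ T₂ T₁ (Product.swap c) (b , a)
  InClosedIn□-swap = Sum.swap ∘ Sum.map Product.swap Product.swap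

  ProductCovering-swap : ∀ {P₁ P₂} → ProductCovering T₁ T₂ P₁ P₂ → ProductCovering T₂ T₁ P₂ P₁
  ProductCovering-swap cover b a with cover a b
  ... | c , cab , x , y , x∈ , y∈ , cxy =
    Product.swap c , InClosedIn□-swap cab , y , x , y∈ , x∈ , InClosedIn□-swap cxy

maxPackingsCover : ∀ {n₁ n₂} {T₁ : Digraph n₁} {T₂ : Digraph n₂} {γ₁ γ₂ γ}
  → IsDitree T₁ → IsDitree T₂ → IsDomNumber T₁ γ₁ → IsDomNumber T₂ γ₂ → IsDomNumber (T₁ □ T₂) γ
  → γ ≡ γ₁ * γ₂ → ∀ {P₁ P₂} → IsMaxPacking T₁ P₁ → IsMaxPacking T₂ P₂ → ProductCovering T₁ T₂ P₁ P₂
maxPackingsCover {T₁ = T₁} {T₂} (irr₁ , _ , acyc₁) (irr₂ , _ , acyc₂) d₁ d₂ ((S , S-dom , ∣S∣≡γ) , _) γ≡ m₁ m₂ =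
  productCovering T₁ T₂ (proj₁ m₁) (proj₁ m₂) S-dom
    (≤-trans (≤-reflexive (trans ∣S∣≡γ γ≡))
             (*-mono-≤ (Forest.domNumber≤∣maxPacking∣ T₁ irr₁ acyc₁ d₁ m₁)
                       (Forest.domNumber≤∣maxPacking∣ T₂ irr₂ acyc₂ d₂ m₂)))

sourcesInMaxPackings : ∀ {n₁ n₂} {T₁ : Digraph n₁} {T₂ : Digraph n₂}
  → (∀ {P₁ P₂} → IsMaxPacking T₁ P₁ → IsMaxPacking T₂ P₂ → ProductCovering T₁ T₂ P₁ P₂)
  → (∀ P → IsMaxPacking T₁ P → ∀ v → Source T₁ v → v ∈ P)
  ⊎ (∀ P → IsMaxPacking T₂ P → ∀ v → Source T₂ v → v ∈ P)
sourcesInMaxPackings {T₁ = T₁} {T₂} cover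
  with anySubset? (λ P → isMaxPacking? T₁ P ×-dec any? (λ v → source? T₁ v ×-dec ¬? (v ∈? P)))
... | yes (P , m , v , src , v∉) =
  inj₂ λ P′ m′ v′ src′ →
    Sum.[ (λ v∈ → contradiction v∈ v∉) , id ] (covering⇒sources T₁ T₂ (cover m m′) src src′)
... | no none = inj₁ λ P m v src → decidable-stable (v ∈? P) λ v∉ → none (P , m , v , src , v∉)

mainTheorem15 : ∀ {n₁ n₂} (T₁ : Digraph n₁) (T₂ : Digraph n₂)
  → IsDitree T₁ → IsDitree T₂ → 3 ≤ n₁ → 3 ≤ n₂
  → (γ₁ γ₂ γ : ℕ) → IsDomNumber T₁ γ₁ → IsDomNumber T₂ γ₂
  → IsDomNumber (T₁ □ T₂) γ → γ ≡ γ₁ * γ₂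
  → ((P₁ : Subset n₁) (P₂ : Subset n₂) → IsMaxPacking T₁ P₁ → IsMaxPacking T₂ P₂
       → DominatesUnderlying T₁ P₁ × DominatesUnderlying T₂ P₂)
    × ((∀ (P : Subset n₁) → IsMaxPacking T₁ P → ∀ v → IsIsolatedLeaf T₁ v → v ∈ P)
       ⊎ (∀ (P : Subset n₂) → IsMaxPacking T₂ P → ∀ v → IsIsolatedLeaf T₂ v → v ∈ P))
mainTheorem15 T₁ T₂ dt₁@(irr₁ , con₁ , _) dt₂@(irr₂ , con₂ , _) 3≤n₁ 3≤n₂ γ₁ γ₂ γ d₁ d₂ d γ≡ =
  (λ P₁ P₂ m₁ m₂ →
      covering⇒dominatesUnderlying T₁ T₂ (cover m₁ m₂) irr₂
        (connected⇒arc T₂ (≤-trans (n≤1+n 2) 3≤n₂) con₂) (proj₁ m₂)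
    , covering⇒dominatesUnderlying T₂ T₁ (ProductCovering-swap T₁ T₂ (cover m₁ m₂)) irr₁
        (connected⇒arc T₁ (≤-trans (n≤1+n 2) 3≤n₁) con₁) (proj₁ m₁))
  , Sum.map (λ h P m v → h P m v ∘ proj₂) (λ h P m v → h P m v ∘ proj₂) (sourcesInMaxPackings cover)
  where
  cover = maxPackingsCover dt₁ dt₂ d₁ d₂ d γ≡
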